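{- Assume $q\ge 3$. (a) For $1\le i\le 6$, each inclusion-minimal element of $N_i$ is of the form $\mathbb{A}^2_q\setminus(\sigma\cap\mathbb{A}^2_q)$, where $\sigma$ is the complement in $\mathbb{P}^2_q$ of some inclusion-minimal element of $N_i'$. (b) For $1\le i\le 6$ and any $\sigma\subseteq\mathbb{P}^2_q$ which is the complement in $\mathbb{P}^2_q$ of an inclusion-minimal element of $N_i'$, the set $\sigma\cap\mathbb{A}^2_q$ is the complement in $\mathbb{A}^2_q$ of an inclusion-minimal element of $N_j$ for some $j\ge i$.
   Context: Let $q$ be a prime power. $\mathrm{PRM}_q(2,2)$ is the code obtained by evaluating all homogeneous quadratic polynomials in $x,y,z$ over $\mathbb{F}_q$ at fixed representatives of the points of $\mathbb{P}^2_q$; $\mathrm{RM}_q(2,2)$ is obtained by evaluating all polynomials in $\mathbb{F}_q[x,y]$ of degree at most $2$ at the points of $\mathbb{A}^2_q=\mathbb{F}_q^2$, where $\mathbb{A}^2_q$ is identified with $\mathbb{P}^2_q\setminus\{z=0\}$ via representatives with $z=1$. Let $M'$ (on ground set $\mathbb{P}^2_q$) and $M$ (on ground set $\mathbb{A}^2_q$) be the parity check matroids of $\mathrm{PRM}_q(2,2)$ and $\mathrm{RM}_q(2,2)$ respectively (independent sets: index sets of linearly independent columns of a parity check matrix), with nullity $|\sigma|-\mathrm{rank}(\sigma)$. $N_i'$ is the set of subsets of $\mathbb{P}^2_q$ of nullity $i$ in $M'$, and $N_i$ the set of subsets of $\mathbb{A}^2_q$ of nullity $i$ in $M$. -}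

module Defs where

open import Level using (0ℓ)
open import Data.Nat using (ℕ; _≤_)
import Data.Nat as N
open import Data.Fin using (Fin; splitAt; remQuot; _↑ˡ_)
open import Data.Fin.Subset using (Subset; _∈_; _∉_; _⊆_; _⊂_; ∣_∣; ∁)
open import Data.Vec using (tabulate; lookup)
open import Data.Sum using (inj₁; inj₂)
open import Data.Product using (Σ; ∃; _×_; _,_; proj₁; proj₂)
open import Relation.Nullary using (¬_)
open import Relation.Binary.PropositionalEquality using (_≡_)
open import Algebra.Bundles using (CommutativeRing)

record FiniteField (q : ℕ) : Set₁ where
  field
    commRing : CommutativeRing 0ℓ 0ℓ
  open CommutativeRing commRing public
  field
    1≉0     : ¬ (1# ≈ 0#)
    inverse : ∀ x → ¬ (x ≈ 0#) → ∃ λ y → (x * y) ≈ 1#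
    enum    : Fin q → Carrier
    enum-injective  : ∀ i j → enum i ≈ enum j → i ≡ j
    enum-surjective : ∀ x → ∃ λ i → enum i ≈ x

HasNullity : ∀ {n} → (Subset n → Set) → Subset n → ℕ → Set
HasNullity Indep σ i =
  (∃ λ ρ → ρ ⊆ σ × Indep ρ × ∣ ρ ∣ N.+ i ≡ ∣ σ ∣)
  × (∀ ρ → ρ ⊆ σ → Indep ρ → ∣ ρ ∣ N.+ i ≤ ∣ σ ∣)

MinimalNullity : ∀ {n} → (Subset n → Set) → Subset n → ℕ → Set
MinimalNullity Indep σ i =
  HasNullity Indep σ i × (∀ ρ → ρ ⊂ σ → ¬ HasNullity Indep ρ i)

module _ {q : ℕ} (K : FiniteField q) where
  open FiniteField K

  Coeffs : Set
  Coeffs = Fin 6 → Carrier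


  evalHom : Coeffs → Carrier → Carrier → Carrier → Carrier
  evalHom f x y z =
    f (# 0) * (x * x) + f (# 1) * (y * y) + f (# 2) * (z * z)
    + f (# 3) * (x * y) + f (# 4) * (x * z) + f (# 5) * (y * z)
    where open import Data.Fin using (#_)

  evalAff : Coeffs → Carrier → Carrier → Carrier
  evalAff f x y =
    f (# 0) * (x * x) + f (# 1) * (y * y) + f (# 2)
    + f (# 3) * (x * y) + f (# 4) * x + f (# 5) * y
    where open import Data.Fin using (#_)

  nA : ℕ
  nA = q N.* q

  affPt : Fin nA → Carrier × Carrier
  affPt k = enum (proj₁ (remQuot {q} q k)) , enum (proj₂ (remQuot {q} q k))

  -- Points of P²_q, indexed by Fin (q N.* q N.+ (q N.+ 1)), with fixed
  -- representatives (x : y : 1), (x : 1 : 0), (1 : 0 : 0).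
  nP : ℕ
  nP = q N.* q N.+ (q N.+ 1)

  projPt : Fin nP → Carrier × Carrier × Carrier
  projPt k with splitAt nA k
  ... | inj₁ a = proj₁ (affPt a) , proj₂ (affPt a) , 1#
  ... | inj₂ b with splitAt q b
  ...   | inj₁ x = enum x , 1# , 0#
  ...   | inj₂ _ = 1# , 0# , 0#

  -- The identification A²_q ⊆ P²_q (points with z = 1).
  ι : Fin nA → Fin nP
  ι a = a ↑ˡ (q N.+ 1)

  restrict : Subset nP → Subset nA
  restrict σ = tabulate (λ a → lookup σ (ι a))

  codeP : Coeffs → Fin nP → Carrier
  codeP f k = evalHom f (proj₁ (projPt k)) (proj₁ (proj₂ (projPt k)))
                         (proj₂ (proj₂ (projPt k)))

  codeA : Coeffs → Fin nA → Carrier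
  codeA f k = evalAff f (proj₁ (affPt k)) (proj₂ (affPt k))

  -- Parity check matroid: a set τ of columns of a parity check matrix H
  -- of a code C is linearly independent iff no nonzero vector supported
  -- on τ lies in ker H = C, i.e. every codeword supported in τ is zero.
  IndepP : Subset nP → Set
  IndepP τ = ∀ f → (∀ k → k ∉ τ → codeP f k ≈ 0#) → ∀ k → codeP f k ≈ 0#

  IndepA : Subset nA → Set
  IndepA τ = ∀ f → (∀ k → k ∉ τ → codeA f k ≈ 0#) → ∀ k → codeA f k ≈ 0#

  MinN' : Subset nP → ℕ → Set
  MinN' = MinimalNullity IndepP

  MinN : Subset nA → ℕ → Set
  MinN = MinimalNullity IndepA

module Submission where

-- For a linear code whose encoding f ↦ (f(P))_P is injective, the nullity of a set σ of points in
-- the parity check matroid is the dimension of the space of messages f whose codeword is supported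
-- in σ; σ is moreover inclusion-minimal of its nullity iff every point of σ lies in the support of
-- such a codeword. RM_q(2,2) is the puncturing of PRM_q(2,2) to the affine chart z = 1, and for
-- q ≥ 3 its encoding is injective (over F₂, x² + x vanishes everywhere). Hence the codewords of RM
-- supported in a minimal τ ⊆ A² come from the same quadratic forms on P², whose supports cover a
-- set μ with the same space of messages, so the same nullity, and with μ ∩ A² = τ. Conversely,
-- restricting a minimal μ ⊆ P² to A² can only enlarge that space, so the nullity can only grow.

open import Defs
open import Level using (0ℓ)
open import Data.Bool using (Bool; true; false; not)
open import Data.Bool.Properties using (not-involutive)
open import Data.Empty using (⊥-elim)
open import Data.Fin as Fin using (Fin; zero; suc; punchIn; #_; combine)
import Data.Fin.Properties as Fin
open import Data.Fin.Subset using (Subset; _∈_; _∉_; _⊆_; _⊂_; ∣_∣; ∁; ⊥; _-_)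
open import Data.Fin.Subset.Properties
  using (_∈?_; nonempty?; ∉⊥; p⊆q⇒∣p∣≤∣q∣; p─⊥≡p; p─q⊆p; x∈p∧x≢y⇒x∈p-y; x∈p⇒p-x⊂p; ⊆-antisym)
open import Data.Fin.Subset.Induction using (⊂-wellFounded; Acc; acc)
open import Data.Nat as ℕ using (ℕ; zero; suc; _≤_; z≤n; s≤s)
import Data.Nat.Properties as ℕ
open import Data.Product using (∃; _×_; _,_; proj₁; proj₂)
open import Data.Sum using (_⊎_; inj₁; inj₂)
open import Data.Vec as Vec using (tabulate; lookup; here; there)
import Data.Vec.Properties as Vec
open import Data.Vec.Functional using (Vector; _∷_; head; tail; replicate; map; zipWith; insertAt)
open import Data.Vec.Functional.Properties using (insertAt-lookup; insertAt-punchIn)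
open import Function using (_∘_; id)
open import Relation.Binary.PropositionalEquality as ≡ using (_≡_; _≢_)
open import Relation.Nullary using (¬_; Dec; yes; no; contradiction)
open import Relation.Nullary.Decidable using (map′; isYes; decidable-stable; ¬?; _×-dec_; _→-dec_)
open import Relation.Unary using (Pred; Decidable)

private
  variable
    d m n : ℕ

-- Subsets

x∈p⇒suc∣p-x∣≡∣p∣ : ∀ {p : Subset n} {x} → x ∈ p → suc ∣ p - x ∣ ≡ ∣ p ∣
x∈p⇒suc∣p-x∣≡∣p∣ {p = true Vec.∷ p} here = ≡.cong (suc ∘ ∣_∣) (p─⊥≡p p)
x∈p⇒suc∣p-x∣≡∣p∣ {p = true Vec.∷ p} (there x∈p) = ≡.cong suc (x∈p⇒suc∣p-x∣≡∣p∣ x∈p)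
x∈p⇒suc∣p-x∣≡∣p∣ {p = false Vec.∷ p} (there x∈p) = x∈p⇒suc∣p-x∣≡∣p∣ x∈p

x∉p-x : ∀ {p : Subset n} x → x ∉ p - x
x∉p-x {p = _ Vec.∷ _} zero ()
x∉p-x {p = _ Vec.∷ _} (suc x) (there x∈p-x) = x∉p-x x x∈p-x

x∉p-y∧x≢y⇒x∉p : ∀ {p : Subset n} {x y} → x ∉ p - y → x ≢ y → x ∉ p
x∉p-y∧x≢y⇒x∉p x∉p-y x≢y x∈p = x∉p-y (x∈p∧x≢y⇒x∈p-y x∈p x≢y)

p⊆q∧x∉p⇒p⊆q-x : ∀ {p q : Subset n} {x} → p ⊆ q → x ∉ p → p ⊆ q - x
p⊆q∧x∉p⇒p⊆q-x p⊆q x∉p y∈p = x∈p∧x≢y⇒x∈p-y (p⊆q y∈p) λ { ≡.refl → x∉p y∈p }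

p-x⊆p : ∀ {p : Subset n} {x} → p - x ⊆ p
p-x⊆p {p = p} = p─q⊆p p _

∁-involutive : (p : Subset n) → ∁ (∁ p) ≡ p
∁-involutive p = ≡.trans (≡.sym (Vec.map-∘ not not p)) (≡.trans (Vec.map-cong not-involutive p) (Vec.map-id p))

∈-tabulate⁺ : ∀ {f : Fin n → Bool} {x} → f x ≡ true → x ∈ tabulate f
∈-tabulate⁺ {f = f} {x} fx≡true = Vec.lookup⇒[]= x (tabulate f) (≡.trans (Vec.lookup∘tabulate f x) fx≡true)

∈-tabulate⁻ : ∀ {f : Fin n → Bool} {x} → x ∈ tabulate f → f x ≡ true
∈-tabulate⁻ {f = f} {x} x∈ = ≡.trans (≡.sym (Vec.lookup∘tabulate f x)) (Vec.[]=⇒lookup x∈)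

subsetOf : ∀ {P : Pred (Fin n) 0ℓ} → Decidable P → Subset n
subsetOf P? = tabulate (isYes ∘ P?)

module _ {P : Pred (Fin n) 0ℓ} (P? : Decidable P) where

  ∈-subsetOf⁺ : ∀ {x} → P x → x ∈ subsetOf P?
  ∈-subsetOf⁺ {x} Px with P? x in eq
  ... | yes _ = ∈-tabulate⁺ (≡.cong isYes eq)
  ... | no ¬Px = contradiction Px ¬Px

  ∈-subsetOf⁻ : ∀ {x} → x ∈ subsetOf P? → P x
  ∈-subsetOf⁻ {x} x∈ with P? x | ∈-tabulate⁻ {f = isYes ∘ P?} x∈
  ... | yes Px | _ = Px

preimage : (Fin m → Fin n) → Subset n → Subset m
preimage ι μ = tabulate (λ a → lookup μ (ι a))

module _ (ι : Fin m → Fin n) (μ : Subset n) {a : Fin m} where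

  ∈-preimage⁺ : ι a ∈ μ → a ∈ preimage ι μ
  ∈-preimage⁺ ιa∈μ = ∈-tabulate⁺ (Vec.[]=⇒lookup ιa∈μ)

  ∈-preimage⁻ : a ∈ preimage ι μ → ι a ∈ μ
  ∈-preimage⁻ a∈ = Vec.lookup⇒[]= (ι a) μ (∈-tabulate⁻ a∈)

preimage-∁ : (ι : Fin m → Fin n) (μ : Subset n) → preimage ι (∁ μ) ≡ ∁ (preimage ι μ)
preimage-∁ ι μ = ≡.trans (Vec.tabulate-cong (λ a → Vec.lookup-map (ι a) not μ))
                         (Vec.tabulate-∘ not (λ a → lookup μ (ι a)))

avoid-two : ∀ {r} (x y : Fin (3 ℕ.+ r)) → ∃ λ z → z ≢ x × z ≢ y
avoid-two zero                zero                = # 1 , (λ ()) , (λ ())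
avoid-two zero                (suc zero)          = # 2 , (λ ()) , (λ ())
avoid-two zero                (suc (suc _))       = # 1 , (λ ()) , (λ ())
avoid-two (suc zero)          zero                = # 2 , (λ ()) , (λ ())
avoid-two (suc zero)          (suc zero)          = # 0 , (λ ()) , (λ ())
avoid-two (suc zero)          (suc (suc _))       = # 0 , (λ ()) , (λ ())
avoid-two (suc (suc _))       zero                = # 1 , (λ ()) , (λ ())
avoid-two (suc (suc _))       (suc zero)          = # 0 , (λ ()) , (λ ())
avoid-two (suc (suc _))       (suc (suc _))       = # 0 , (λ ()) , (λ ())

HasNullity-unique : ∀ {I : Subset n → Set} {σ i j} → HasNullity I σ i → HasNullity I σ j → i ≡ j
HasNullity-unique {i = i} {j} ((ρ , ρ⊆σ , ρ-indep , ∣ρ∣+i≡∣σ∣) , bound) ((ρ′ , ρ′⊆σ , ρ′-indep , ∣ρ′∣+j≡∣σ∣) , bound′) =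
  ℕ.≤-antisym (ℕ.+-cancelˡ-≤ ∣ ρ′ ∣ i j (≡.subst (∣ ρ′ ∣ ℕ.+ i ≤_) (≡.sym ∣ρ′∣+j≡∣σ∣) (bound ρ′ ρ′⊆σ ρ′-indep)))
              (ℕ.+-cancelˡ-≤ ∣ ρ ∣ j i (≡.subst (∣ ρ ∣ ℕ.+ j ≤_) (≡.sym ∣ρ∣+i≡∣σ∣) (bound′ ρ ρ⊆σ ρ-indep)))

-- Linear algebra over a finite field and parity check matroids

module _ {q : ℕ} (K : FiniteField q) where

  open FiniteField K hiding (zero; _-_)
  open import Relation.Binary.Reasoning.Setoid setoid
  open import Data.Vec.Functional.Relation.Binary.Equality.Setoid setoid using (_≋_)
  open import Algebra.Properties.Semiring.Sum semiring using (sum; sum-syntax; sum-cong-≋; sum-replicate-zero; sum-remove; ∑-distrib-+; *-distribʳ-sum)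
  open import Algebra.Properties.Ring ring using (-‿distribˡ-*)
  open import Algebra.Properties.Group +-group using (∙-cancelʳ)
  import Tactic.RingSolver.Core.AlmostCommutativeRing as ACR
  open import Data.Maybe using (nothing)
  open import Tactic.RingSolver.NonReflective (ACR.fromCommutativeRing commRing (λ _ → nothing))
    using (solve; _⊜_; _⊕_; _⊗_)

  _≈?_ : (x y : Carrier) → Dec (x ≈ y)
  x ≈? y with enum-surjective x | enum-surjective y
  ... | i , eᵢ≈x | j , eⱼ≈y = map′ (λ { ≡.refl → trans (sym eᵢ≈x) eⱼ≈y })
                                    (λ x≈y → enum-injective i j (trans eᵢ≈x (trans x≈y (sym eⱼ≈y))))
                                    (i Fin.≟ j)

  ≈-stable : ∀ {x y} → ¬ ¬ x ≈ y → x ≈ y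
  ≈-stable {x} {y} = decidable-stable (x ≈? y)

  *-cancelʳ-≈0 : ∀ {x y} → x * y ≈ 0# → ¬ y ≈ 0# → x ≈ 0#
  *-cancelʳ-≈0 {x} {y} xy≈0 y≉0 with inverse y y≉0
  ... | y⁻¹ , yy⁻¹≈1 = begin
    x              ≈⟨ *-identityʳ x ⟨
    x * 1#         ≈⟨ *-congˡ yy⁻¹≈1 ⟨
    x * (y * y⁻¹)  ≈⟨ *-assoc x y y⁻¹ ⟨
    x * y * y⁻¹    ≈⟨ *-congʳ xy≈0 ⟩
    0# * y⁻¹       ≈⟨ zeroˡ y⁻¹ ⟩
    0#             ∎

  *-cancelˡ-≉0 : ∀ {u x y} → ¬ u ≈ 0# → u * x ≈ u * y → x ≈ y
  *-cancelˡ-≉0 {u} {x} {y} u≉0 ux≈uy with inverse u u≉0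
  ... | w , uw≈1 = begin
    x            ≈⟨ *-identityˡ x ⟨
    1# * x       ≈⟨ *-congʳ (trans (*-comm w u) uw≈1) ⟨
    w * u * x    ≈⟨ *-assoc w u x ⟩
    w * (u * x)  ≈⟨ *-congˡ ux≈uy ⟩
    w * (u * y)  ≈⟨ *-assoc w u y ⟨
    w * u * y    ≈⟨ *-congʳ (trans (*-comm w u) uw≈1) ⟩
    1# * y       ≈⟨ *-identityˡ y ⟩
    y            ∎

  x≈0⇒x+y≈y : ∀ {x y} → x ≈ 0# → x + y ≈ y
  x≈0⇒x+y≈y {x} {y} x≈0 = trans (+-congʳ x≈0) (+-identityˡ y)

  y≈0⇒x+y≈x : ∀ {x y} → y ≈ 0# → x + y ≈ x
  y≈0⇒x+y≈x {x} {y} y≈0 = trans (+-congˡ y≈0) (+-identityʳ x)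

  exists-≉0-≉1 : 3 ≤ q → ∃ λ a → ¬ a ≈ 0# × ¬ a ≈ 1#
  exists-≉0-≉1 (s≤s (s≤s (s≤s _))) with enum-surjective 0# | enum-surjective 1#
  ... | i₀ , eᵢ₀≈0 | i₁ , eᵢ₁≈1 with avoid-two i₀ i₁
  ... | j , j≢i₀ , j≢i₁ =
    enum j , (λ eⱼ≈0 → j≢i₀ (enum-injective j i₀ (trans eⱼ≈0 (sym eᵢ₀≈0))))
           , (λ eⱼ≈1 → j≢i₁ (enum-injective j i₁ (trans eⱼ≈1 (sym eᵢ₁≈1))))

  any-vector? : ∀ d {P : Pred (Vector Carrier d) 0ℓ} →
                (∀ {f g} → f ≋ g → P f → P g) → Decidable P → Dec (∃ P)
  any-vector? zero P-resp P? = map′ (λ Pf → _ , Pf) (λ (f , Pf) → P-resp (λ ()) Pf) (P? (λ ()))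
  any-vector? (suc d) {P} P-resp P? =
    map′ (λ (i , f , Pf) → _ , Pf) split
         (Fin.any? λ i → any-vector? d (λ f≋g → P-resp (λ { zero → refl ; (suc c) → f≋g c })) (P? ∘ (enum i ∷_)))
    where
    split : ∃ P → ∃ λ i → ∃ λ f → P (enum i ∷ f)
    split (f , Pf) with enum-surjective (head f)
    ... | i , eᵢ≈f₀ = i , tail f , P-resp (λ { zero → sym eᵢ≈f₀ ; (suc c) → refl }) Pf

  pivot-cancel : ∀ {y w} → y * w ≈ 1# → ∀ u → u + - (u * w) * y ≈ 0#
  pivot-cancel {y} {w} yw≈1 u = begin
    u + - (u * w) * y    ≈⟨ +-congˡ (-‿distribˡ-* (u * w) y) ⟨
    u + - (u * w * y)    ≈⟨ +-congˡ (-‿cong (trans (*-assoc u w y) (*-congˡ (*-comm w y)))) ⟩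
    u + - (u * (y * w))  ≈⟨ +-congˡ (-‿cong (*-congˡ yw≈1)) ⟩
    u + - (u * 1#)       ≈⟨ +-congˡ (-‿cong (*-identityʳ u)) ⟩
    u + - u              ≈⟨ -‿inverseʳ u ⟩
    0#                   ∎

  sum-≈0 : ∀ {v : Vector Carrier m} → (∀ i → v i ≈ 0#) → sum v ≈ 0#
  sum-≈0 {m} v≈0 = trans (sum-cong-≋ v≈0) (sum-replicate-zero m)

  0ᵥ : Vector Carrier d
  0ᵥ = replicate _ 0#

  infixl 6 _+ᵥ_
  infixl 7 _*ᵥ_

  _+ᵥ_ : Vector Carrier d → Vector Carrier d → Vector Carrier d
  _+ᵥ_ = zipWith _+_

  _*ᵥ_ : Carrier → Vector Carrier d → Vector Carrier d
  a *ᵥ f = map (a *_) f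

  combination : Vector Carrier m → Vector (Vector Carrier d) m → Vector Carrier d
  combination {m} a h c = ∑[ i < m ] (a i * h i c)

  LinearlyIndependent : Vector (Vector Carrier d) m → Set
  LinearlyIndependent h = ∀ a → combination a h ≋ 0ᵥ → ∀ i → a i ≈ 0#

  record HasDimension (S : Pred (Vector Carrier d) 0ℓ) (n : ℕ) : Set where
    field
      basis       : Vector (Vector Carrier d) n
      basis∈      : ∀ i → S (basis i)
      independent : LinearlyIndependent basis
      bound       : ∀ {m} (h : Vector (Vector Carrier d) m) → (∀ i → S (h i)) → LinearlyIndependent h → m ≤ n

  record IsSubspace (S : Pred (Vector Carrier d) 0ℓ) : Set where
    field
      +-closed : ∀ {f g} → S f → S g → S (f +ᵥ g)
      *-closed : ∀ {f} a → S f → S (a *ᵥ f)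

  record IsLinearForm (φ : Vector Carrier d → Carrier) : Set where
    field
      cong  : ∀ {f g} → f ≋ g → φ f ≈ φ g
      +-hom : ∀ f g → φ (f +ᵥ g) ≈ φ f + φ g
      *-hom : ∀ a f → φ (a *ᵥ f) ≈ a * φ f

  Kernel : Pred (Vector Carrier d) 0ℓ → (Vector Carrier d → Carrier) → Pred (Vector Carrier d) 0ℓ
  Kernel S φ f = S f × φ f ≈ 0#

  private
    variable
      S S′ : Pred (Vector Carrier d) 0ℓ
      i j : ℕ

  dim-mono : (∀ {f} → S f → S′ f) → HasDimension S i → HasDimension S′ j → i ≤ j
  dim-mono S⊆S′ dimS dimS′ = HasDimension.bound dimS′ basis (S⊆S′ ∘ basis∈) independent
    where open HasDimension dimS

  dim-unique : HasDimension S i → HasDimension S j → i ≡ j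
  dim-unique dimᵢ dimⱼ = ℕ.≤-antisym (dim-mono id dimᵢ dimⱼ) (dim-mono id dimⱼ dimᵢ)

  dim-resp : (∀ {f} → S f → S′ f) → (∀ {f} → S′ f → S f) → HasDimension S n → HasDimension S′ n
  dim-resp S⊆S′ S′⊆S dimS = record
    { basis       = basis
    ; basis∈      = S⊆S′ ∘ basis∈
    ; independent = independent
    ; bound       = λ h h∈S′ → bound h (S′⊆S ∘ h∈S′)
    }
    where open HasDimension dimS

  dim-trivial : (∀ {f} → S f → f ≋ 0ᵥ) → HasDimension S 0
  dim-trivial {S = S} S≋0 = record { basis = λ () ; basis∈ = λ () ; independent = λ _ _ () ; bound = bound }
    where
    bound : ∀ {m} h → (∀ i → S (h i)) → LinearlyIndependent h → m ≤ 0
    bound {zero} _ _ _ = z≤n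
    bound {suc m} h h∈S h-indep =
      ⊥-elim (1≉0 (h-indep (replicate _ 1#) (λ c → sum-≈0 λ i → trans (*-congˡ (S≋0 (h∈S i) c)) (zeroʳ 1#)) zero))

  dim-zero⇒trivial : HasDimension S 0 → ∀ {f} → S f → f ≋ 0ᵥ
  dim-zero⇒trivial dimS {f} f∈S c = ≈-stable λ fc≉0 →
    contradiction (HasDimension.bound dimS (λ _ → f) (λ _ → f∈S) (singleton-independent fc≉0)) λ ()
    where
    singleton-independent : ¬ f c ≈ 0# → LinearlyIndependent {m = 1} (λ _ → f)
    singleton-independent fc≉0 a comb≋0 zero = *-cancelʳ-≈0 (trans (sym (+-identityʳ _)) (comb≋0 c)) fc≉0

  independent⇒head≉0 : {h : Vector (Vector Carrier d) (suc m)} → LinearlyIndependent h → ¬ h zero ≋ 0ᵥ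
  independent⇒head≉0 {h = h} h-indep h₀≋0 = 1≉0 (h-indep (1# ∷ replicate _ 0#) comb≋0 zero)
    where
    comb≋0 : combination (1# ∷ replicate _ 0#) h ≋ 0ᵥ
    comb≋0 c = begin
      1# * h zero c + ∑[ i < _ ] (0# * h (suc i) c)  ≈⟨ +-cong (trans (*-identityˡ _) (h₀≋0 c)) (sum-≈0 λ i → zeroˡ (h (suc i) c)) ⟩
      0# + 0#                                        ≈⟨ +-identityʳ 0# ⟩
      0#                                             ∎

  nonzero-of-dim-suc : HasDimension S (suc n) → ∃ λ f → S f × ¬ f ≋ 0ᵥ
  nonzero-of-dim-suc dimS = basis zero , basis∈ zero , independent⇒head≉0 {h = basis} independent
    where open HasDimension dimS

  IsLinearForm-resp : {φ ψ : Vector Carrier d → Carrier} → (∀ f → φ f ≈ ψ f) → IsLinearForm φ → IsLinearForm ψ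
  IsLinearForm-resp φ≈ψ φ-linear = record
    { cong  = λ f≋g → trans (sym (φ≈ψ _)) (trans (cong f≋g) (φ≈ψ _))
    ; +-hom = λ f g → trans (sym (φ≈ψ _)) (trans (+-hom f g) (+-cong (φ≈ψ f) (φ≈ψ g)))
    ; *-hom = λ a f → trans (sym (φ≈ψ _)) (trans (*-hom a f) (*-congˡ (φ≈ψ f)))
    }
    where open IsLinearForm φ-linear

  module LinearForm {φ : Vector Carrier d → Carrier} (φ-linear : IsLinearForm φ) where
    open IsLinearForm φ-linear

    φ-0ᵥ : φ 0ᵥ ≈ 0#
    φ-0ᵥ = begin
      φ 0ᵥ          ≈⟨ cong (λ _ → sym (zeroˡ 0#)) ⟩
      φ (0# *ᵥ 0ᵥ)  ≈⟨ *-hom 0# 0ᵥ ⟩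
      0# * φ 0ᵥ     ≈⟨ zeroˡ _ ⟩
      0#            ∎

    φ-combination : (a : Vector Carrier m) (h : Vector (Vector Carrier d) m) →
                    φ (combination a h) ≈ ∑[ i < m ] (a i * φ (h i))
    φ-combination {zero} a h = trans (cong λ _ → refl) φ-0ᵥ
    φ-combination {suc m} a h = begin
      φ (head a *ᵥ head h +ᵥ combination (tail a) (tail h))   ≈⟨ +-hom _ _ ⟩
      φ (head a *ᵥ head h) + φ (combination (tail a) (tail h)) ≈⟨ +-cong (*-hom _ _) (φ-combination (tail a) (tail h)) ⟩
      head a * φ (head h) + ∑[ i < m ] (a (suc i) * φ (h (suc i))) ∎

  combination-shift : (a : Vector Carrier m) (h : Vector (Vector Carrier d) m) (e : Vector Carrier m) (g : Vector Carrier d) →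
    combination a (λ i → h i +ᵥ e i *ᵥ g) ≋ combination a h +ᵥ (∑[ i < m ] (a i * e i)) *ᵥ g
  combination-shift {m} a h e g c = begin
    ∑[ i < m ] (a i * (h i c + e i * g c))           ≈⟨ sum-cong-≋ (λ i → trans (distribˡ (a i) (h i c) (e i * g c)) (+-congˡ (sym (*-assoc (a i) (e i) (g c))))) ⟩
    ∑[ i < m ] (a i * h i c + a i * e i * g c)       ≈⟨ ∑-distrib-+ (λ i → a i * h i c) (λ i → a i * e i * g c) ⟩
    combination a h c + ∑[ i < m ] (a i * e i * g c) ≈⟨ +-congˡ (*-distribʳ-sum (g c) (λ i → a i * e i)) ⟨
    combination a h c + (∑[ i < m ] (a i * e i)) * g c ∎

  eliminate-independent : {H : Vector (Vector Carrier d) (suc m)} → LinearlyIndependent H →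
    ∀ p (e : Vector Carrier m) → LinearlyIndependent (λ i → H (punchIn p i) +ᵥ e i *ᵥ H p)
  eliminate-independent {m = m} {H = H} H-indep p e a comb≋0 i = begin
    a i              ≡⟨ insertAt-punchIn a p t i ⟨
    b (punchIn p i)  ≈⟨ H-indep b lifted≋0 (punchIn p i) ⟩
    0#               ∎
    where
    t = ∑[ j < m ] (a j * e j)
    b = insertAt a p t
    lifted≋0 : combination b H ≋ 0ᵥ
    lifted≋0 c = begin
      combination b H c
        ≈⟨ sum-remove {i = p} (λ j → b j * H j c) ⟩
      b p * H p c + combination (b ∘ punchIn p) (H ∘ punchIn p) c
        ≈⟨ +-cong (*-congʳ (reflexive (insertAt-lookup a p t)))
                  (sum-cong-≋ λ j → *-congʳ (reflexive (insertAt-punchIn a p t j))) ⟩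
      t * H p c + combination a (H ∘ punchIn p) c
        ≈⟨ +-comm _ _ ⟩
      combination a (H ∘ punchIn p) c + t * H p c
        ≈⟨ combination-shift a (H ∘ punchIn p) e (H p) c ⟨
      combination a (λ i → H (punchIn p i) +ᵥ e i *ᵥ H p) c
        ≈⟨ comb≋0 c ⟩
      0# ∎

  module _ {S : Pred (Vector Carrier d) 0ℓ} {φ : Vector Carrier d → Carrier} (S-subspace : IsSubspace S) (φ-linear : IsLinearForm φ) where
    open IsSubspace S-subspace
    open IsLinearForm φ-linear using (+-hom; *-hom)
    open LinearForm φ-linear

    -- Gaussian elimination: if some φ (H p) ≉ 0, subtracting multiples of H p from the other
    -- members yields an independent family of size m - 1 inside the kernel.
    dim≤suc-dim-kernel : HasDimension (Kernel S φ) j →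
      (H : Vector (Vector Carrier d) m) → (∀ i → S (H i)) → LinearlyIndependent H → m ≤ suc j
    dim≤suc-dim-kernel {m = zero} _ _ _ _ = z≤n
    dim≤suc-dim-kernel {m = suc m} dimK H H∈S H-indep with Fin.any? (λ p → ¬? (φ (H p) ≈? 0#))
    ... | no ∄pivot = ℕ.m≤n⇒m≤1+n (bound H (λ i → H∈S i , ≈-stable λ φHᵢ≉0 → ∄pivot (i , φHᵢ≉0)) H-indep)
      where open HasDimension dimK
    ... | yes (p , φHₚ≉0) with inverse (φ (H p)) φHₚ≉0
    ...   | w , φHₚw≈1 = s≤s (HasDimension.bound dimK H′ H′∈kernel (eliminate-independent {H = H} H-indep p e))
      where
      e : Vector Carrier m
      e i = - (φ (H (punchIn p i)) * w)
      H′ : Vector (Vector Carrier d) m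
      H′ i = H (punchIn p i) +ᵥ e i *ᵥ H p
      H′∈kernel : ∀ i → Kernel S φ (H′ i)
      H′∈kernel i = +-closed (H∈S _) (*-closed _ (H∈S p)) , (begin
        φ (H′ i)                             ≈⟨ +-hom _ _ ⟩
        φ (H (punchIn p i)) + φ (e i *ᵥ H p) ≈⟨ +-congˡ (*-hom _ _) ⟩
        φ (H (punchIn p i)) + e i * φ (H p)  ≈⟨ pivot-cancel φHₚw≈1 _ ⟩
        0#                                   ∎)

    dim-suc-of-kernel : ∀ {g} → S g → ¬ φ g ≈ 0# → HasDimension (Kernel S φ) j → HasDimension S (suc j)
    dim-suc-of-kernel {g = g} g∈S φg≉0 dimK = record
      { basis       = g ∷ basis
      ; basis∈      = λ { zero → g∈S ; (suc i) → proj₁ (basis∈ i) }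
      ; independent = extended-independent
      ; bound       = dim≤suc-dim-kernel dimK
      }
      where
      open HasDimension dimK
      extended-independent : LinearlyIndependent (g ∷ basis)
      extended-independent a comb≋0 = λ { zero → a₀≈0 ; (suc i) → independent (tail a) tail≋0 i }
        where
        a₀≈0 : head a ≈ 0#
        a₀≈0 = *-cancelʳ-≈0 (begin
          head a * φ g                           ≈⟨ +-identityʳ _ ⟨
          head a * φ g + 0#                      ≈⟨ +-congˡ (sum-≈0 λ i → trans (*-congˡ (proj₂ (basis∈ i))) (zeroʳ _)) ⟨
          ∑[ i < _ ] (a i * φ ((g ∷ basis) i))   ≈⟨ φ-combination a (g ∷ basis) ⟨
          φ (combination a (g ∷ basis))          ≈⟨ IsLinearForm.cong φ-linear comb≋0 ⟩
          φ 0ᵥ                                   ≈⟨ φ-0ᵥ ⟩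
          0#                                     ∎) φg≉0
        tail≋0 : combination (tail a) basis ≋ 0ᵥ
        tail≋0 c = begin
          combination (tail a) basis c           ≈⟨ +-identityˡ _ ⟨
          0# + combination (tail a) basis c      ≈⟨ +-congʳ (trans (*-congʳ a₀≈0) (zeroˡ (g c))) ⟨
          head a * g c + combination (tail a) basis c ≈⟨ comb≋0 c ⟩
          0#                                     ∎

  module ParityCheckMatroid
    (code : Vector Carrier d → Fin n → Carrier)
    (code-linear : ∀ k → IsLinearForm (λ f → code f k))
    (code-injective : ∀ {f} → (∀ k → code f k ≈ 0#) → f ≋ 0ᵥ)
    where

    Supported : Subset n → Pred (Vector Carrier d) 0ℓ
    Supported σ f = ∀ k → k ∉ σ → code f k ≈ 0#

    -- For code = codeP K (codeA K) this is definitionally IndepP K (IndepA K).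
    Independent : Subset n → Set
    Independent τ = ∀ f → Supported τ f → ∀ k → code f k ≈ 0#

    Nonvanishing : Subset n → (Vector Carrier d → Carrier) → Set
    Nonvanishing σ φ = ∃ λ g → Supported σ g × ¬ φ g ≈ 0#

    InSupport : Subset n → Fin n → Set
    InSupport σ k = Nonvanishing σ (λ f → code f k)

    private
      variable
        σ ρ : Subset n
        k : Fin n

    supported-subspace : IsSubspace (Supported σ)
    supported-subspace = record
      { +-closed = λ {f} {g} f∈σ g∈σ k k∉σ →
          trans (IsLinearForm.+-hom (code-linear k) f g) (trans (+-cong (f∈σ k k∉σ) (g∈σ k k∉σ)) (+-identityʳ 0#))
      ; *-closed = λ {f} a f∈σ k k∉σ →
          trans (IsLinearForm.*-hom (code-linear k) a f) (trans (*-congˡ (f∈σ k k∉σ)) (zeroʳ a))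
      }

    supported-mono : ρ ⊆ σ → ∀ {f} → Supported ρ f → Supported σ f
    supported-mono ρ⊆σ f∈ρ k k∉σ = f∈ρ k (k∉σ ∘ ρ⊆σ)

    supported? : ∀ σ → Decidable (Supported σ)
    supported? σ f = Fin.all? λ k → ¬? (k ∈? σ) →-dec (code f k ≈? 0#)

    nonvanishing? : ∀ σ {φ} → IsLinearForm φ → Dec (Nonvanishing σ φ)
    nonvanishing? σ {φ} φ-linear = any-vector? _ resp (λ g → supported? σ g ×-dec ¬? (φ g ≈? 0#))
      where
      resp : ∀ {f g} → f ≋ g → Supported σ f × ¬ φ f ≈ 0# → Supported σ g × ¬ φ g ≈ 0#
      resp f≋g (f∈σ , φf≉0) =
        (λ k k∉σ → trans (sym (IsLinearForm.cong (code-linear k) f≋g)) (f∈σ k k∉σ)) ,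
        (λ φg≈0 → φf≉0 (trans (IsLinearForm.cong φ-linear f≋g) φg≈0))

    inSupport? : ∀ σ k → Dec (InSupport σ k)
    inSupport? σ k = nonvanishing? σ (code-linear k)

    inSupport⇒∈ : InSupport σ k → k ∈ σ
    inSupport⇒∈ {σ} {k} (g , g∈σ , gk≉0) = decidable-stable (k ∈? σ) λ k∉σ → gk≉0 (g∈σ k k∉σ)

    code-of-zero : ∀ {f} → f ≋ 0ᵥ → ∀ k → code f k ≈ 0#
    code-of-zero f≋0 k = trans (IsLinearForm.cong (code-linear k) f≋0) (LinearForm.φ-0ᵥ (code-linear k))

    ⊥-independent : Independent ⊥
    ⊥-independent f f∈⊥ k = f∈⊥ k ∉⊥

    supported-minus⁻ : ∀ {f} → Supported (σ - k) f → Kernel (Supported σ) (λ f → code f k) f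
    supported-minus⁻ {k = k} f∈σ-k = (λ x x∉σ → f∈σ-k x (x∉σ ∘ p-x⊆p)) , f∈σ-k k (x∉p-x k)

    supported-minus⁺ : ∀ {f} → Kernel (Supported σ) (λ f → code f k) f → Supported (σ - k) f
    supported-minus⁺ {k = k} (f∈σ , fk≈0) x x∉σ-k with x Fin.≟ k
    ... | yes ≡.refl = fk≈0
    ... | no x≢k = f∈σ x (x∉p-y∧x≢y⇒x∉p x∉σ-k x≢k)

    dim-minus-inSupport : InSupport σ k → HasDimension (Supported (σ - k)) j → HasDimension (Supported σ) (suc j)
    dim-minus-inSupport (g , g∈σ , gk≉0) dimσ-k =
      dim-suc-of-kernel supported-subspace (code-linear _) g∈σ gk≉0 (dim-resp supported-minus⁻ supported-minus⁺ dimσ-k)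

    dim-minus-¬inSupport : ¬ InSupport σ k → HasDimension (Supported (σ - k)) j → HasDimension (Supported σ) j
    dim-minus-¬inSupport k∉supp = dim-resp (supported-mono p-x⊆p)
      (λ f∈σ → supported-minus⁺ (f∈σ , ≈-stable λ fk≉0 → k∉supp (_ , f∈σ , fk≉0)))

    dimension : ∀ σ → ∃ (HasDimension (Supported σ))
    dimension σ = go σ (⊂-wellFounded σ)
      where
      go : ∀ σ → Acc _⊂_ σ → ∃ (HasDimension (Supported σ))
      go σ (acc rec) with nonempty? σ
      ... | no σ-empty = 0 , dim-trivial λ f∈σ → code-injective λ k → f∈σ k λ k∈σ → σ-empty (k , k∈σ)
      ... | yes (k , k∈σ) with go (σ - k) (rec (x∈p⇒p-x⊂p k∈σ)) | inSupport? σ k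
      ...   | j , dimσ-k | yes k∈supp = suc j , dim-minus-inSupport k∈supp dimσ-k
      ...   | j , dimσ-k | no k∉supp = j , dim-minus-¬inSupport k∉supp dimσ-k

    dim-minus : InSupport σ k → HasDimension (Supported σ) (suc j) → HasDimension (Supported (σ - k)) j
    dim-minus {σ = σ} {k} k∈supp dimσ with dimension (σ - k)
    ... | j , dimσ-k with dim-unique (dim-minus-inSupport k∈supp dimσ-k) dimσ
    ... | ≡.refl = dimσ-k

    inSupport-outside : Independent ρ → HasDimension (Supported σ) (suc j) → ∃ λ k → k ∉ ρ × InSupport σ k
    inSupport-outside {ρ} ρ-indep dimσ with nonzero-of-dim-suc dimσ
    ... | g , g∈σ , g≉0 with Fin.¬∀⟶∃¬ n _ (λ k → ¬? (k ∈? ρ) →-dec (code g k ≈? 0#)) (λ g∈ρ → g≉0 (code-injective (ρ-indep g g∈ρ)))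
    ... | k , g∉ρ = k , (λ k∈ρ → g∉ρ λ k∉ρ → contradiction k∈ρ k∉ρ) , g , g∈σ , λ gk≈0 → g∉ρ λ _ → gk≈0

    independent-bound : HasDimension (Supported σ) i → ρ ⊆ σ → Independent ρ → ∣ ρ ∣ ℕ.+ i ≤ ∣ σ ∣
    independent-bound {i = zero} _ ρ⊆σ _ = ℕ.≤-trans (ℕ.≤-reflexive (ℕ.+-identityʳ _)) (p⊆q⇒∣p∣≤∣q∣ ρ⊆σ)
    independent-bound {i = suc i} {ρ = ρ} dimσ ρ⊆σ ρ-indep with inSupport-outside ρ-indep dimσ
    ... | k , k∉ρ , k∈supp =
      ≡.subst₂ _≤_ (≡.sym (ℕ.+-suc ∣ ρ ∣ i)) (x∈p⇒suc∣p-x∣≡∣p∣ (inSupport⇒∈ k∈supp))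
        (s≤s (independent-bound (dim-minus k∈supp dimσ) (p⊆q∧x∉p⇒p⊆q-x ρ⊆σ k∉ρ) ρ-indep))

    independent-complement : HasDimension (Supported σ) i → ∃ λ ρ → ρ ⊆ σ × Independent ρ × ∣ ρ ∣ ℕ.+ i ≡ ∣ σ ∣
    independent-complement {σ = σ} {i = zero} dimσ =
      σ , id , (λ f f∈σ → code-of-zero (dim-zero⇒trivial dimσ f∈σ)) , ℕ.+-identityʳ _
    independent-complement {i = suc i} dimσ with inSupport-outside ⊥-independent dimσ
    ... | k , _ , k∈supp with independent-complement (dim-minus k∈supp dimσ)
    ... | ρ , ρ⊆σ-k , ρ-indep , ∣ρ∣+i≡∣σ-k∣ =
      ρ , p-x⊆p ∘ ρ⊆σ-k , ρ-indep ,
      ≡.trans (ℕ.+-suc _ i) (≡.trans (≡.cong suc ∣ρ∣+i≡∣σ-k∣) (x∈p⇒suc∣p-x∣≡∣p∣ (inSupport⇒∈ k∈supp)))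

    dim⇒hasNullity : HasDimension (Supported σ) i → HasNullity Independent σ i
    dim⇒hasNullity dimσ = independent-complement dimσ , λ ρ ρ⊆σ ρ-indep → independent-bound dimσ ρ⊆σ ρ-indep

    hasNullity⇒dim : HasNullity Independent σ i → HasDimension (Supported σ) i
    hasNullity⇒dim {σ = σ} σ-nullity with dimension σ
    ... | j , dimσ with HasNullity-unique (dim⇒hasNullity dimσ) σ-nullity
    ... | ≡.refl = dimσ

    minimal⇒inSupport : MinimalNullity Independent σ i → k ∈ σ → InSupport σ k
    minimal⇒inSupport {σ = σ} {k = k} (σ-nullity , minimal) k∈σ with inSupport? σ k
    ... | yes k∈supp = k∈supp
    ... | no k∉supp with dimension (σ - k)
    ...   | j , dimσ-k with dim-unique (dim-minus-¬inSupport k∉supp dimσ-k) (hasNullity⇒dim σ-nullity)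
    ...     | ≡.refl = contradiction (dim⇒hasNullity dimσ-k) (minimal (σ - k) (x∈p⇒p-x⊂p k∈σ))

    inSupport⇒minimal : HasNullity Independent σ i → (∀ {k} → k ∈ σ → InSupport σ k) → MinimalNullity Independent σ i
    inSupport⇒minimal {σ = σ} {i = i} σ-nullity σ-inSupport = σ-nullity , no-smaller
      where
      no-smaller : ∀ ρ → ρ ⊂ σ → ¬ HasNullity Independent ρ i
      no-smaller ρ (ρ⊆σ , k , k∈σ , k∉ρ) ρ-nullity with dimension (σ - k)
      ... | j , dimσ-k with dim-unique (hasNullity⇒dim σ-nullity) (dim-minus-inSupport (σ-inSupport k∈σ) dimσ-k)
      ... | ≡.refl = ℕ.n≮n j (dim-mono (supported-mono (p⊆q∧x∉p⇒p⊆q-x ρ⊆σ k∉ρ)) (hasNullity⇒dim ρ-nullity) dimσ-k)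

  module Puncturing
    (codeP : Vector Carrier d → Fin n → Carrier)
    (codeP-linear : ∀ x → IsLinearForm (λ f → codeP f x))
    (ι : Fin m → Fin n)
    (codeA : Vector Carrier d → Fin m → Carrier)
    (codeP∘ι≈codeA : ∀ f a → codeP f (ι a) ≈ codeA f a)
    (codeA-injective : ∀ {f} → (∀ a → codeA f a ≈ 0#) → f ≋ 0ᵥ)
    where

    codeA-linear : ∀ a → IsLinearForm (λ f → codeA f a)
    codeA-linear a = IsLinearForm-resp (λ f → codeP∘ι≈codeA f a) (codeP-linear (ι a))

    codeP-injective : ∀ {f} → (∀ x → codeP f x ≈ 0#) → f ≋ 0ᵥ
    codeP-injective codeP≈0 = codeA-injective λ a → trans (sym (codeP∘ι≈codeA _ a)) (codeP≈0 (ι a))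

    module P = ParityCheckMatroid codeP codeP-linear codeP-injective
    module A = ParityCheckMatroid codeA codeA-linear codeA-injective

    private
      variable
        f : Vector Carrier d
        a : Fin m

    codeP-ι≉0 : ¬ codeA f a ≈ 0# → ¬ codeP f (ι a) ≈ 0#
    codeP-ι≉0 {f} {a} fa≉0 fιa≈0 = fa≉0 (trans (sym (codeP∘ι≈codeA f a)) fιa≈0)

    codeA≉0 : ¬ codeP f (ι a) ≈ 0# → ¬ codeA f a ≈ 0#
    codeA≉0 {f} {a} fιa≉0 fa≈0 = fιa≉0 (trans (codeP∘ι≈codeA f a) fa≈0)

    supportedP⇒supportedA : ∀ {μ} →  P.Supported μ f → A.Supported (preimage ι μ) f
    supportedP⇒supportedA {f} {μ} f∈μ a a∉ = trans (sym (codeP∘ι≈codeA f a)) (f∈μ (ι a) (a∉ ∘ ∈-preimage⁺ ι μ))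

    minimal-extends : ∀ {τ} → MinimalNullity A.Independent τ i →
                      ∃ λ μ → MinimalNullity P.Independent μ i × τ ≡ preimage ι μ
    minimal-extends {i} {τ} τ-minimal = μ , μ-minimal , ⊆-antisym τ⊆ι⁻¹μ ι⁻¹μ⊆τ
      where
      μ? : Decidable λ x → A.Nonvanishing τ (λ f → codeP f x)
      μ? x = A.nonvanishing? τ (codeP-linear x)

      μ : Subset n
      μ = subsetOf μ?

      supportedA⇒supportedP : A.Supported τ f → P.Supported μ f
      supportedA⇒supportedP {f} f∈τ x x∉μ = ≈-stable λ fx≉0 → x∉μ (∈-subsetOf⁺ μ? (f , f∈τ , fx≉0))

      supportedP⇒supportedA′ : P.Supported μ f → A.Supported τ f
      supportedP⇒supportedA′ {f} f∈μ a a∉τ = trans (sym (codeP∘ι≈codeA f a)) (f∈μ (ι a) ιa∉μ)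
        where
        ιa∉μ : ι a ∉ μ
        ιa∉μ ιa∈μ = let g , g∈τ , gιa≉0 = ∈-subsetOf⁻ μ? ιa∈μ in codeA≉0 gιa≉0 (g∈τ a a∉τ)

      μ-dim : HasDimension (P.Supported μ) i
      μ-dim = dim-resp supportedA⇒supportedP supportedP⇒supportedA′ (A.hasNullity⇒dim (proj₁ τ-minimal))

      μ-minimal : MinimalNullity P.Independent μ i
      μ-minimal = P.inSupport⇒minimal (P.dim⇒hasNullity μ-dim) λ x∈μ →
        let g , g∈τ , gx≉0 = ∈-subsetOf⁻ μ? x∈μ in g , supportedA⇒supportedP g∈τ , gx≉0

      τ⊆ι⁻¹μ : τ ⊆ preimage ι μ
      τ⊆ι⁻¹μ a∈τ = let g , g∈τ , ga≉0 = A.minimal⇒inSupport τ-minimal a∈τ in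
        ∈-preimage⁺ ι μ (∈-subsetOf⁺ μ? (g , g∈τ , codeP-ι≉0 ga≉0))

      ι⁻¹μ⊆τ : preimage ι μ ⊆ τ
      ι⁻¹μ⊆τ a∈ι⁻¹μ = let g , g∈τ , gιa≉0 = ∈-subsetOf⁻ μ? (∈-preimage⁻ ι μ a∈ι⁻¹μ) in
        A.inSupport⇒∈ (g , g∈τ , codeA≉0 gιa≉0)

    minimal-restricts : ∀ {μ} → MinimalNullity P.Independent μ i →
                        ∃ λ j → i ≤ j × MinimalNullity A.Independent (preimage ι μ) j
    minimal-restricts {μ = μ} μ-minimal with A.dimension (preimage ι μ)
    ... | j , ι⁻¹μ-dim =
      j , dim-mono supportedP⇒supportedA (P.hasNullity⇒dim (proj₁ μ-minimal)) ι⁻¹μ-dim ,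
      A.inSupport⇒minimal (A.dim⇒hasNullity ι⁻¹μ-dim) λ a∈ι⁻¹μ →
        let g , g∈μ , gιa≉0 = P.minimal⇒inSupport μ-minimal (∈-preimage⁻ ι μ a∈ι⁻¹μ) in
        g , supportedP⇒supportedA g∈μ , codeA≉0 gιa≉0

  -- The quadratic Reed–Muller codes

  +-cong₆ : ∀ {a₀ a₁ a₂ a₃ a₄ a₅ b₀ b₁ b₂ b₃ b₄ b₅} → a₀ ≈ b₀ → a₁ ≈ b₁ → a₂ ≈ b₂ → a₃ ≈ b₃ → a₄ ≈ b₄ → a₅ ≈ b₅ →
            a₀ + a₁ + a₂ + a₃ + a₄ + a₅ ≈ b₀ + b₁ + b₂ + b₃ + b₄ + b₅
  +-cong₆ e₀ e₁ e₂ e₃ e₄ e₅ = +-cong (+-cong (+-cong (+-cong (+-cong e₀ e₁) e₂) e₃) e₄) e₅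

  evalHom-linear : ∀ x y z → IsLinearForm (λ f → evalHom K f x y z)
  evalHom-linear x y z = record
    { cong  = λ f≋g → +-cong₆ (*-congʳ (f≋g _)) (*-congʳ (f≋g _)) (*-congʳ (f≋g _))
                              (*-congʳ (f≋g _)) (*-congʳ (f≋g _)) (*-congʳ (f≋g _))
    ; +-hom = λ f g → trans (+-cong₆ (distribʳ _ _ _) (distribʳ _ _ _) (distribʳ _ _ _)
                                     (distribʳ _ _ _) (distribʳ _ _ _) (distribʳ _ _ _))
                            (interchange₆ _ _ _ _ _ _ _ _ _ _ _ _)
    ; *-hom = λ c f → trans (+-cong₆ (*-assoc c _ _) (*-assoc c _ _) (*-assoc c _ _)
                                     (*-assoc c _ _) (*-assoc c _ _) (*-assoc c _ _))
                            (factor₆ c _ _ _ _ _ _)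
    }
    where
    interchange₆ : ∀ a₀ a₁ a₂ a₃ a₄ a₅ b₀ b₁ b₂ b₃ b₄ b₅ →
      (a₀ + b₀) + (a₁ + b₁) + (a₂ + b₂) + (a₃ + b₃) + (a₄ + b₄) + (a₅ + b₅) ≈
      (a₀ + a₁ + a₂ + a₃ + a₄ + a₅) + (b₀ + b₁ + b₂ + b₃ + b₄ + b₅)
    interchange₆ = solve 12 (λ a₀ a₁ a₂ a₃ a₄ a₅ b₀ b₁ b₂ b₃ b₄ b₅ →
      ((a₀ ⊕ b₀) ⊕ (a₁ ⊕ b₁) ⊕ (a₂ ⊕ b₂) ⊕ (a₃ ⊕ b₃) ⊕ (a₄ ⊕ b₄) ⊕ (a₅ ⊕ b₅)) ⊜
      ((a₀ ⊕ a₁ ⊕ a₂ ⊕ a₃ ⊕ a₄ ⊕ a₅) ⊕ (b₀ ⊕ b₁ ⊕ b₂ ⊕ b₃ ⊕ b₄ ⊕ b₅))) refl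
    factor₆ : ∀ c a₀ a₁ a₂ a₃ a₄ a₅ →
      c * a₀ + c * a₁ + c * a₂ + c * a₃ + c * a₄ + c * a₅ ≈ c * (a₀ + a₁ + a₂ + a₃ + a₄ + a₅)
    factor₆ = solve 7 (λ c a₀ a₁ a₂ a₃ a₄ a₅ →
      (c ⊗ a₀ ⊕ c ⊗ a₁ ⊕ c ⊗ a₂ ⊕ c ⊗ a₃ ⊕ c ⊗ a₄ ⊕ c ⊗ a₅) ⊜ (c ⊗ (a₀ ⊕ a₁ ⊕ a₂ ⊕ a₃ ⊕ a₄ ⊕ a₅))) refl

  codeP∘ι≈codeA : ∀ f a → codeP K f (ι K a) ≈ codeA K f a
  codeP∘ι≈codeA f a rewrite Fin.splitAt-↑ˡ (nA K) a (q ℕ.+ 1) =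
    +-cong₆ refl refl (trans (*-congˡ (*-identityˡ 1#)) (*-identityʳ _)) refl (*-congˡ (*-identityʳ _)) (*-congˡ (*-identityʳ _))

  quadratic : Carrier → Carrier → Carrier → Carrier
  quadratic u v x = u * (x * x) + v * x

  quadratic-at-0 : ∀ u v → quadratic u v 0# ≈ 0#
  quadratic-at-0 u v = trans (+-cong (trans (*-congˡ (zeroˡ 0#)) (zeroʳ u)) (zeroʳ v)) (+-identityʳ 0#)

  quadratic-at-1 : ∀ u v → quadratic u v 1# ≈ u + v
  quadratic-at-1 u v = +-cong (trans (*-congˡ (*-identityˡ 1#)) (*-identityʳ u)) (*-identityʳ v)

  quadratic-roots : ∀ {a u v} → ¬ a ≈ 0# → ¬ a ≈ 1# → quadratic u v 1# ≈ 0# → quadratic u v a ≈ 0# → u ≈ 0# × v ≈ 0#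
  quadratic-roots {a} {u} {v} a≉0 a≉1 root₁ rootₐ = u≈0 , v≈0
    where
    u+v≈0 : u + v ≈ 0#
    u+v≈0 = trans (sym (quadratic-at-1 u v)) root₁
    ua+v≈0 : u * a + v ≈ 0#
    ua+v≈0 = *-cancelʳ-≈0 (trans (distribʳ a (u * a) v) (trans (+-congʳ (*-assoc u a a)) rootₐ)) a≉0
    u≈0 : u ≈ 0#
    u≈0 = ≈-stable λ u≉0 → a≉1 (*-cancelˡ-≉0 u≉0 (trans (∙-cancelʳ v (u * a) (u * 1#)
            (trans ua+v≈0 (trans (sym u+v≈0) (+-congʳ (sym (*-identityʳ u)))))) refl))
    v≈0 : v ≈ 0#
    v≈0 = trans (sym (trans (+-congʳ u≈0) (+-identityˡ v))) u+v≈0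

  evalAff-cong : ∀ f {x x′ y y′} → x ≈ x′ → y ≈ y′ → evalAff K f x y ≈ evalAff K f x′ y′
  evalAff-cong f x≈x′ y≈y′ = +-cong₆ (*-congˡ (*-cong x≈x′ x≈x′)) (*-congˡ (*-cong y≈y′ y≈y′)) refl
                                     (*-congˡ (*-cong x≈x′ y≈y′)) (*-congˡ x≈x′) (*-congˡ y≈y′)

  evalAff-regroup : ∀ f x y → evalAff K f x y ≈
    f (# 2) + (quadratic (f (# 0)) (f (# 4)) x + (quadratic (f (# 1)) (f (# 5)) y + f (# 3) * (x * y)))
  evalAff-regroup f x y = regroup _ _ _ _ _ _
    where
    regroup : ∀ p₀ p₁ p₂ p₃ p₄ p₅ → p₀ + p₁ + p₂ + p₃ + p₄ + p₅ ≈ p₂ + ((p₀ + p₄) + ((p₁ + p₅) + p₃))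
    regroup = solve 6 (λ p₀ p₁ p₂ p₃ p₄ p₅ →
      (p₀ ⊕ p₁ ⊕ p₂ ⊕ p₃ ⊕ p₄ ⊕ p₅) ⊜ (p₂ ⊕ ((p₀ ⊕ p₄) ⊕ ((p₁ ⊕ p₅) ⊕ p₃)))) refl

  codeA-vanishes⇒evalAff-vanishes : ∀ {f} → (∀ k → codeA K f k ≈ 0#) → ∀ x y → evalAff K f x y ≈ 0#
  codeA-vanishes⇒evalAff-vanishes {f} codeA≈0 x y with enum-surjective x | enum-surjective y
  ... | i , eᵢ≈x | j , eⱼ≈y =
    trans (evalAff-cong f (sym eᵢ≈x) (sym eⱼ≈y))
          (≡.subst (λ (i , j) → evalAff K f (enum i) (enum j) ≈ 0#) (Fin.remQuot-combine i j) (codeA≈0 (combine i j)))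

  codeA-injective : 3 ≤ q → ∀ {f} → (∀ k → codeA K f k ≈ 0#) → f ≋ 0ᵥ
  codeA-injective q≥3 {f} codeA≈0 = λ
    { zero                                → proj₁ f₀,f₄≈0
    ; (suc zero)                          → proj₁ f₁,f₅≈0
    ; (suc (suc zero))                    → f₂≈0
    ; (suc (suc (suc zero)))              → f₃≈0
    ; (suc (suc (suc (suc zero))))        → proj₂ f₀,f₄≈0
    ; (suc (suc (suc (suc (suc zero)))))  → proj₂ f₁,f₅≈0
    }
    where
    q₀ q₁ : Carrier → Carrier
    q₀ = quadratic (f (# 0)) (f (# 4))
    q₁ = quadratic (f (# 1)) (f (# 5))

    E : ∀ x y → f (# 2) + (q₀ x + (q₁ y + f (# 3) * (x * y))) ≈ 0#
    E x y = trans (sym (evalAff-regroup f x y)) (codeA-vanishes⇒evalAff-vanishes {f} codeA≈0 x y)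

    f₃-term≈0 : ∀ {x y} → y ≈ 0# ⊎ x ≈ 0# → f (# 3) * (x * y) ≈ 0#
    f₃-term≈0 (inj₁ y≈0) = trans (*-congˡ (trans (*-congˡ y≈0) (zeroʳ _))) (zeroʳ _)
    f₃-term≈0 (inj₂ x≈0) = trans (*-congˡ (trans (*-congʳ x≈0) (zeroˡ _))) (zeroʳ _)

    f₂≈0 : f (# 2) ≈ 0#
    f₂≈0 = trans (sym (y≈0⇒x+y≈x (trans (x≈0⇒x+y≈y (quadratic-at-0 _ _))
                                        (trans (x≈0⇒x+y≈y (quadratic-at-0 _ _)) (f₃-term≈0 (inj₁ refl))))))
                 (E 0# 0#)

    q₀≈0 : ∀ x → q₀ x ≈ 0#
    q₀≈0 x = trans (sym (y≈0⇒x+y≈x (trans (x≈0⇒x+y≈y (quadratic-at-0 _ _)) (f₃-term≈0 (inj₁ refl)))))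
                   (trans (sym (x≈0⇒x+y≈y f₂≈0)) (E x 0#))

    q₁≈0 : ∀ y → q₁ y ≈ 0#
    q₁≈0 y = trans (sym (trans (x≈0⇒x+y≈y f₂≈0) (trans (x≈0⇒x+y≈y (quadratic-at-0 _ _))
                                                      (y≈0⇒x+y≈x (f₃-term≈0 (inj₂ refl))))))
                   (E 0# y)

    f₃≈0 : f (# 3) ≈ 0#
    f₃≈0 = trans (sym (trans (*-congˡ (*-identityˡ 1#)) (*-identityʳ _)))
                 (trans (sym (trans (x≈0⇒x+y≈y f₂≈0) (trans (x≈0⇒x+y≈y (q₀≈0 1#)) (x≈0⇒x+y≈y (q₁≈0 1#)))))
                        (E 1# 1#))

    a≉0,1 = exists-≉0-≉1 q≥3

    f₀,f₄≈0 : f (# 0) ≈ 0# × f (# 4) ≈ 0#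
    f₀,f₄≈0 = quadratic-roots (proj₁ (proj₂ a≉0,1)) (proj₂ (proj₂ a≉0,1)) (q₀≈0 1#) (q₀≈0 _)

    f₁,f₅≈0 : f (# 1) ≈ 0# × f (# 5) ≈ 0#
    f₁,f₅≈0 = quadratic-roots (proj₁ (proj₂ a≉0,1)) (proj₂ (proj₂ a≉0,1)) (q₁≈0 1#) (q₁≈0 _)

propositionA5 : ∀ {q : ℕ} (K : FiniteField q) → 3 ≤ q →
    ((i : ℕ) → 1 ≤ i → i ≤ 6 → (τ : Subset (nA K)) → MinN K τ i →
      ∃ λ (μ : Subset (nP K)) → MinN' K μ i × τ ≡ ∁ (restrict K (∁ μ)))
    × ((i : ℕ) → 1 ≤ i → i ≤ 6 → (μ : Subset (nP K)) → MinN' K μ i →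
      ∃ λ (j : ℕ) → i ≤ j × (∃ λ (τ : Subset (nA K)) →
        MinN K τ j × restrict K (∁ μ) ≡ ∁ τ))
propositionA5 K q≥3 =
  (λ i _ _ τ τ-minimal →
    let μ , μ-minimal , τ≡ι⁻¹μ = minimal-extends τ-minimal in
    μ , μ-minimal , ≡.trans τ≡ι⁻¹μ (≡.sym (≡.trans (≡.cong ∁ (preimage-∁ (ι K) μ)) (∁-involutive _)))) ,
  (λ i _ _ μ μ-minimal →
    let j , i≤j , ι⁻¹μ-minimal = minimal-restricts μ-minimal in
    j , i≤j , preimage (ι K) μ , ι⁻¹μ-minimal , preimage-∁ (ι K) μ)
  where
  open Puncturing K (codeP K) (λ _ → evalHom-linear K _ _ _) (ι K) (codeA K) (codeP∘ι≈codeA K) (codeA-injective K q≥3)
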